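{- Let $A=(a_0,\dots,a_{n-1})$ be an array of pairwise distinct numbers, $k_1<k_2$ positive integers, and run the following greedy algorithm: set $i=0$; repeat: find the smallest $j\ge i$ such that $(a_i,\dots,a_j)$ contains an increasing subsequence of length $k_2$ (stop if none exists) — call $(i,j)$ the computed prefix; find the largest $q\le j$ such that $(a_q,\dots,a_j)$ contains an increasing subsequence of length $k_1$ — call $(q,j)$ the computed suffix; set $i=q$. Consider any two consecutive steps. In the first, let $S=(b,c)$ be the computed suffix and $Y=(y_1,\dots,y_{k_1})$ the lexicographically minimal increasing subsequence of length $k_1$ in $(a_b,\dots,a_c)$. In the second, let $P'=(b,d)$ be the computed prefix and $X'=(x'_1,\dots,x'_{k_2})$ the lexicographically minimal increasing subsequence of length $k_2$ in $(a_b,\dots,a_d)$ (all $x'_t,y_t$ denote positions). Then $x'_i\ge y_i$ for all $1\le i\le k_1$.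
   Context: Increasing subsequences are identified with their increasing sequences of positions; lexicographic minimality refers to comparing these position sequences lexicographically. -}

module Defs where

open import Data.Nat using (ℕ; zero; suc; _≤_; _<_)
open import Data.Integer as ℤ using (ℤ)
open import Data.Product using (_×_; Σ; ∃-syntax)
open import Data.Sum using (_⊎_)
open import Relation.Binary.PropositionalEquality using (_≡_; _≢_)
open import Relation.Nullary using (¬_)

-- An array of length n is a : ℕ → ℤ, of which only positions 0 … n-1 matter.
-- Pairwise distinct entries:
Distinct : ℕ → (ℕ → ℤ) → Set
Distinct n a = ∀ i j → i < n → j < n → i ≢ j → a i ≢ a j

-- p : ℕ → ℕ encodes the position sequence (p 0, …, p (k-1)) (0-based indexing).
IncSub : (ℕ → ℤ) → ℕ → ℕ → ℕ → (ℕ → ℕ) → Set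
IncSub a k i j p =
  (∀ t → t < k → (i ≤ p t) × (p t ≤ j)) ×
  (∀ s t → s < t → t < k → (p s < p t) × (a (p s) ℤ.< a (p t)))

HasInc : (ℕ → ℤ) → ℕ → ℕ → ℕ → Set
HasInc a k i j = Σ (ℕ → ℕ) (IncSub a k i j)

LexLeq : ℕ → (ℕ → ℕ) → (ℕ → ℕ) → Set
LexLeq k p q =
  (∀ t → t < k → p t ≡ q t) ⊎
  (∃[ t ] ((t < k) × (∀ s → s < t → p s ≡ q s) × (p t < q t)))

LexMinInc : (ℕ → ℤ) → ℕ → ℕ → ℕ → (ℕ → ℕ) → Set
LexMinInc a k i j p = IncSub a k i j p × (∀ q → IncSub a k i j q → LexLeq k p q)

IsPrefix : ℕ → (ℕ → ℤ) → ℕ → ℕ → ℕ → Set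
IsPrefix n a k₂ i j =
  (i ≤ j) × (j < n) × HasInc a k₂ i j ×
  (∀ j' → i ≤ j' → j' < j → ¬ HasInc a k₂ i j')

IsSuffix : (ℕ → ℤ) → ℕ → ℕ → ℕ → Set
IsSuffix a k₁ q j =
  (q ≤ j) × HasInc a k₁ q j ×
  (∀ q' → q < q' → q' ≤ j → ¬ HasInc a k₁ q' j)

data Reached (n : ℕ) (a : ℕ → ℤ) (k₁ k₂ : ℕ) : ℕ → Set where
  start : Reached n a k₁ k₂ 0
  step  : ∀ {i j q} → Reached n a k₁ k₂ i → IsPrefix n a k₂ i j →
          IsSuffix a k₁ q j → Reached n a k₁ k₂ q

-- Write x ↗ y when position x precedes y and a x < a y.  Since b is the latest start, the
-- lexicographically minimal Y is even pointwise minimal among all increasing k₁-subsequences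
-- of [b, j]: a subsequence Z with Z s < Y s either has Z s ↗ Y s, and then Z's entries 1 … s
-- followed by Y's tail start after b, or it has a (Z s) > a (Y s), and then Y's head followed
-- by Z's tail is lexicographically smaller than Y.
-- Now suppose X t < Y t.  If ever X u ↗ Y (u+1) for some u ≥ t, then X's head followed by Y's
-- tail would lie in [b, j] and beat Y at t.  If Y u ↗ X u for some u < k₁, then Y's head
-- followed by X's tail, shifted by one, is an increasing k₂-subsequence ending before d.
-- Together these keep X strictly left of Y from t up to k₁ - 1, so the first k₁ entries of X
-- lie in [b, j] and beat Y at t.
module Submission where

open import Defs
open import Data.Nat using (ℕ; zero; suc; pred; z≤n; s≤s; _≤_; _<_; _≤?_)
open import Data.Nat.Properties
open import Data.Integer as ℤ using (ℤ)
import Data.Integer.Properties as ℤP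
open import Data.Product using (_×_; _,_; proj₁; proj₂)
open import Data.Sum using (inj₁; inj₂)
open import Function using (_∘_)
open import Relation.Nullary using (¬_; yes; no; contradiction)
open import Relation.Binary.PropositionalEquality using (_≡_; refl; sym; cong; subst; subst₂)
open import Relation.Binary.Definitions using (tri<; tri≈; tri>)

pred<self : ∀ {t k} → t < k → pred k < k
pred<self (s≤s _) = ≤-refl

lexLeq⇒≤ : ∀ {k p q s} → LexLeq k p q → (∀ t → t < s → p t ≡ q t) → s < k → p s ≤ q s
lexLeq⇒≤ (inj₁ equal) _ s<k = ≤-reflexive (equal _ s<k)
lexLeq⇒≤ {s = s} (inj₂ (t , _ , agree , pt<qt)) agreeBelow _ with <-cmp t s
... | tri< t<s _ _ = contradiction (agreeBelow t t<s) (<⇒≢ pt<qt)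
... | tri≈ _ refl _ = <⇒≤ pt<qt
... | tri> _ _ s<t = ≤-reflexive (agree s s<t)

splice : ℕ → (ℕ → ℕ) → (ℕ → ℕ) → ℕ → ℕ
splice w f g t with t ≤? w
... | yes _ = f t
... | no _ = g t

splice-≤ : ∀ w f g {t} → t ≤ w → splice w f g t ≡ f t
splice-≤ w f g {t} t≤w with t ≤? w
... | yes _ = refl
... | no t≰w = contradiction t≤w t≰w

splice-> : ∀ w f g {t} → w < t → splice w f g t ≡ g t
splice-> w f g {t} w<t with t ≤? w
... | yes t≤w = contradiction w<t (≤⇒≯ t≤w)
... | no _ = refl

module _ (a : ℕ → ℤ) where

  infix 4 _↗_
  _↗_ : ℕ → ℕ → Set
  x ↗ y = (x < y) × (a x ℤ.< a y)

  ↗-trans : ∀ {x y z} → x ↗ y → y ↗ z → x ↗ z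
  ↗-trans (x<y , ax<ay) (y<z , ay<az) = <-trans x<y y<z , ℤP.<-trans ax<ay ay<az

  Increasing : ℕ → (ℕ → ℕ) → Set
  Increasing k p = ∀ s t → s < t → t < k → p s ↗ p t

  Chain : ℕ → (ℕ → ℕ) → Set
  Chain k p = ∀ t → suc t < k → p t ↗ p (suc t)

  LatestStart : ℕ → ℕ → ℕ → Set
  LatestStart k b j = ¬ HasInc a k (suc b) j

  EarliestEnd : ℕ → ℕ → ℕ → Set
  EarliestEnd k b d = ∀ j' → b ≤ j' → j' < d → ¬ HasInc a k b j'

  Increasing⇒mono : ∀ {k p} → Increasing k p → ∀ {s t} → s ≤ t → t < k → p s ≤ p t
  Increasing⇒mono inc s≤t t<k with m≤n⇒m<n∨m≡n s≤t
  ... | inj₁ s<t = <⇒≤ (proj₁ (inc _ _ s<t t<k))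
  ... | inj₂ refl = ≤-refl

  Chain⇒Increasing : ∀ {k p} → Chain k p → Increasing k p
  Chain⇒Increasing chain s (suc t) s<1+t 1+t<k with m≤n⇒m<n∨m≡n (≤-pred s<1+t)
  ... | inj₁ s<t = ↗-trans (Chain⇒Increasing chain s t s<t (<-trans (n<1+n t) 1+t<k)) (chain t 1+t<k)
  ... | inj₂ refl = chain s 1+t<k

  Chain⇒IncSub : ∀ {k i j p} → Chain k p → i ≤ p 0 → p (pred k) ≤ j → IncSub a k i j p
  Chain⇒IncSub {k} {i} {j} {p} chain i≤p₀ pₖ≤j = bounds , increasing
    where
    increasing = Chain⇒Increasing chain
    bounds : ∀ t → t < k → (i ≤ p t) × (p t ≤ j)
    bounds t t<k =
      ≤-trans i≤p₀ (Increasing⇒mono increasing z≤n t<k) ,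
      ≤-trans (Increasing⇒mono increasing (pred-mono-≤ t<k) (pred<self t<k)) pₖ≤j

  module _ {k i j p} (I : IncSub a k i j p) where

    IncSub-↗ : ∀ {s t} → s < t → t < k → p s ↗ p t
    IncSub-↗ s<t t<k = proj₂ I _ _ s<t t<k

    IncSub-lower : ∀ {t} → t < k → i ≤ p t
    IncSub-lower t<k = proj₁ (proj₁ I _ t<k)

    IncSub-upper : ∀ {t} → t < k → p t ≤ j
    IncSub-upper t<k = proj₂ (proj₁ I _ t<k)

    IncSub⇒Chain : ∀ {m} → m ≤ k → Chain m p
    IncSub⇒Chain m≤k t 1+t<m = IncSub-↗ (n<1+n t) (<-≤-trans 1+t<m m≤k)

  splice-IncSub : ∀ {k i j} w f g → suc w < k → Chain (suc w) f → f w ↗ g (suc w) →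
    (∀ t → w < t → suc t < k → g t ↗ g (suc t)) → i ≤ f 0 → g (pred k) ≤ j →
    IncSub a k i j (splice w f g)
  splice-IncSub {k} {i} {j} w f g 1+w<k f-chain junction g-chain i≤f₀ gₖ≤j =
    Chain⇒IncSub chain
      (subst (i ≤_) (sym (splice-≤ w f g z≤n)) i≤f₀)
      (subst (_≤ j) (sym (splice-> w f g (pred-mono-≤ 1+w<k))) gₖ≤j)
    where
    chain : Chain k (splice w f g)
    chain t 1+t<k with <-cmp t w
    ... | tri< t<w _ _ =
      subst₂ _↗_ (sym (splice-≤ w f g (<⇒≤ t<w))) (sym (splice-≤ w f g t<w))
        (f-chain t (s≤s t<w))
    ... | tri≈ _ refl _ =
      subst₂ _↗_ (sym (splice-≤ w f g ≤-refl)) (sym (splice-> w f g ≤-refl)) junction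
    ... | tri> _ _ w<t =
      subst₂ _↗_ (sym (splice-> w f g w<t)) (sym (splice-> w f g (<-trans w<t (n<1+n t))))
        (g-chain t w<t 1+t<k)

  latestStart⇒head≤ : ∀ {k b j Y} → LatestStart k b j → IncSub a k b j Y → 0 < k → Y 0 ≤ b
  latestStart⇒head≤ {b = b} {Y = Y} latest I 0<k with Y 0 ≤? b
  ... | yes Y₀≤b = Y₀≤b
  ... | no Y₀≰b =
    contradiction (Y , Chain⇒IncSub (IncSub⇒Chain I ≤-refl) (≰⇒> Y₀≰b) (IncSub-upper I (pred<self 0<k)))
      latest

  latestStart⇒¬↗ : ∀ {k k' b j d p Y} w → LatestStart k b j →
    IncSub a k' b d p → IncSub a k b j Y →
    suc w < k → suc w < k' → ¬ p (suc w) ↗ Y (suc w)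
  latestStart⇒¬↗ {p = p} {Y} w latest Ip IY 1+w<k 1+w<k' p↗Y =
    latest (splice w (p ∘ suc) Y ,
      splice-IncSub w (p ∘ suc) Y 1+w<k
        (λ t 1+t<1+w → IncSub⇒Chain Ip 1+w<k' (suc t) (s≤s 1+t<1+w))
        p↗Y
        (λ t _ → IncSub⇒Chain IY ≤-refl t)
        (≤-<-trans (IncSub-lower Ip 0<k') (proj₁ (IncSub-↗ Ip (s≤s z≤n) 1<k')))
        (IncSub-upper IY (pred<self 1+w<k)))
    where
    1<k' = ≤-<-trans (s≤s z≤n) 1+w<k'
    0<k' = <-trans (s≤s z≤n) 1<k'

  -- Y's entries 0 … u followed by X (u), …, X (k₂ - 2) form a k₂-subsequence ending at X (k₂ - 2).
  earliestEnd⇒¬↗ : ∀ {k₁ k₂ b j d u Y X} → EarliestEnd k₂ b d →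
    IncSub a k₁ b j Y → IncSub a k₂ b d X →
    k₁ < k₂ → u < k₁ → ¬ Y u ↗ X u
  earliestEnd⇒¬↗ {k₂ = suc (suc m)} {u = u} {Y} {X} earliest IY IX k₁<k₂ u<k₁ Yu↗Xu =
    earliest (X m) (IncSub-lower IX m<k₂) Xm<d
      (splice u Y (X ∘ pred) ,
       splice-IncSub u Y (X ∘ pred) (≤-<-trans u<k₁ k₁<k₂) (IncSub⇒Chain IY u<k₁) Yu↗Xu
         X-chain (IncSub-lower IY (≤-<-trans z≤n u<k₁)) ≤-refl)
    where
    m<k₂ = <-trans (n<1+n m) (n<1+n (suc m))
    Xm<d = <-≤-trans (proj₁ (IncSub-↗ IX (n<1+n m) ≤-refl)) (IncSub-upper IX ≤-refl)
    X-chain : ∀ t → u < t → suc t < suc (suc m) → X (pred t) ↗ X t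
    X-chain (suc t) _ 2+t<k₂ = IncSub-↗ IX (n<1+n t) (<⇒≤ 2+t<k₂)
  earliestEnd⇒¬↗ {k₂ = suc zero} _ _ _ (s≤s z≤n) ()

  LexMinInc⇒pointwise≤ : ∀ {n k b j Y Z} → Distinct n a → j < n → LatestStart k b j →
    LexMinInc a k b j Y → IncSub a k b j Z → ∀ s → s < k → Y s ≤ Z s
  LexMinInc⇒pointwise≤ {k = k} {b} {j} {Y} {Z} distinct j<n latest (IY , lexMin) IZ = go
    where
    go : ∀ s → s < k → Y s ≤ Z s
    go zero 0<k = ≤-trans (latestStart⇒head≤ latest IY 0<k) (IncSub-lower IZ 0<k)
    go (suc s) 1+s<k = ≮⇒≥ ¬Z<Y
      where
      ¬Z<Y : ¬ Z (suc s) < Y (suc s)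
      ¬Z<Y Z<Y with ℤP.<-cmp (a (Z (suc s))) (a (Y (suc s)))
      ... | tri< aZ<aY _ _ = latestStart⇒¬↗ s latest IZ IY 1+s<k 1+s<k (Z<Y , aZ<aY)
      ... | tri≈ _ aZ≡aY _ =
        distinct _ _ (≤-<-trans (IncSub-upper IZ 1+s<k) j<n) (≤-<-trans (IncSub-upper IY 1+s<k) j<n)
          (<⇒≢ Z<Y) aZ≡aY
      ... | tri> _ _ aY<aZ =
        <⇒≱ Z<Y (subst (Y (suc s) ≤_) (splice-> s Y Z ≤-refl)
                  (lexLeq⇒≤ (lexMin W IW) agree 1+s<k))
        where
        W = splice s Y Z
        Ys↗Zs : Y s ↗ Z (suc s)
        Ys↗Zs = ≤-<-trans (go s (<-trans (n<1+n s) 1+s<k)) (proj₁ (IncSub-↗ IZ (n<1+n s) 1+s<k)) ,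
                ℤP.<-trans (proj₂ (IncSub-↗ IY (n<1+n s) 1+s<k)) aY<aZ
        IW : IncSub a k b j W
        IW = splice-IncSub s Y Z 1+s<k (IncSub⇒Chain IY (<⇒≤ 1+s<k)) Ys↗Zs
               (λ t _ → IncSub⇒Chain IZ ≤-refl t)
               (IncSub-lower IY (<-trans (s≤s z≤n) 1+s<k)) (IncSub-upper IZ (pred<self 1+s<k))
        agree : ∀ t → t < suc s → Y t ≡ W t
        agree t t<1+s = sym (splice-≤ s Y Z (≤-pred t<1+s))

  LexMinInc≤earliestEnd : ∀ {n k₁ k₂ b j d Y X} → Distinct n a → j < n → k₁ < k₂ →
    LatestStart k₁ b j → EarliestEnd k₂ b d → LexMinInc a k₁ b j Y → IncSub a k₂ b d X →
    ∀ t → t < k₁ → Y t ≤ X t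
  LexMinInc≤earliestEnd {k₁ = k₁} {b = b} {j} {Y = Y} {X}
                        distinct j<n k₁<k₂ latest earliest LY IX t t<k₁ = ≮⇒≥ ¬X<Y
    where
    IY = proj₁ LY
    0<k₂ = ≤-<-trans z≤n (<-trans t<k₁ k₁<k₂)

    Y≤ : ∀ {Z} → IncSub a k₁ b j Z → Y t ≤ Z t
    Y≤ IZ = LexMinInc⇒pointwise≤ distinct j<n latest LY IZ t t<k₁

    ¬X<Y : ¬ X t < Y t
    ¬X<Y Xt<Yt = <⇒≱ Xt<Yt (Y≤ X-head)
      where
      ¬rejoin : ∀ {u} → t ≤ u → suc u < k₁ → ¬ X u ↗ Y (suc u)
      ¬rejoin {u} t≤u 1+u<k₁ Xu↗Y1+u =
        <⇒≱ Xt<Yt (subst (Y t ≤_) (splice-≤ u X Y t≤u) (Y≤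
          (splice-IncSub u X Y 1+u<k₁ (IncSub⇒Chain IX (<⇒≤ (<-trans 1+u<k₁ k₁<k₂))) Xu↗Y1+u
             (λ t' _ → IncSub⇒Chain IY ≤-refl t')
             (IncSub-lower IX 0<k₂) (IncSub-upper IY (pred<self 1+u<k₁)))))

      stays-below : ∀ {u} → t ≤ u → suc u < k₁ → X u < Y u → X (suc u) < Y (suc u)
      stays-below {u} t≤u 1+u<k₁ Xu<Yu = ≰⇒> λ Y≤X →
        ¬rejoin t≤u 1+u<k₁
          (<-trans Xu<Yu (proj₁ (IncSub-↗ IY (n<1+n u) 1+u<k₁)) ,
           ℤP.<-≤-trans (proj₂ (IncSub-↗ IX (n<1+n u) (<-trans 1+u<k₁ k₁<k₂))) (aX≤aY Y≤X))
        where
        aX≤aY : Y (suc u) ≤ X (suc u) → a (X (suc u)) ℤ.≤ a (Y (suc u))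
        aX≤aY Y≤X with m≤n⇒m<n∨m≡n Y≤X
        ... | inj₁ Y<X =
          ℤP.≮⇒≥ λ aY<aX → earliestEnd⇒¬↗ earliest IY IX k₁<k₂ 1+u<k₁ (Y<X , aY<aX)
        ... | inj₂ Y≡X = ℤP.≤-reflexive (cong a (sym Y≡X))

      below : ∀ u → t ≤ u → u < k₁ → X u < Y u
      below zero t≤0 _ = subst (λ v → X v < Y v) (n≤0⇒n≡0 t≤0) Xt<Yt
      below (suc u) t≤1+u 1+u<k₁ with m≤n⇒m<n∨m≡n t≤1+u
      ... | inj₁ t<1+u =
        stays-below (≤-pred t<1+u) 1+u<k₁ (below u (≤-pred t<1+u) (<-trans (n<1+n u) 1+u<k₁))
      ... | inj₂ t≡1+u = subst (λ v → X v < Y v) t≡1+u Xt<Yt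

      X-head : IncSub a k₁ b j X
      X-head = Chain⇒IncSub (IncSub⇒Chain IX (<⇒≤ k₁<k₂)) (IncSub-lower IX 0<k₂)
        (<⇒≤ (<-≤-trans (below (pred k₁) (pred-mono-≤ t<k₁) (pred<self t<k₁))
                         (IncSub-upper IY (pred<self t<k₁))))

-- The reached start i and its prefix (i, j) only serve to make (b, j) a computed suffix.
lemma9 : (n : ℕ) (a : ℕ → ℤ) (k₁ k₂ : ℕ) → Distinct n a → 0 < k₁ → k₁ < k₂ →
    ∀ (i j b d : ℕ) (Y X' : ℕ → ℕ) →
    Reached n a k₁ k₂ i →
    IsPrefix n a k₂ i j → IsSuffix a k₁ b j →
    IsPrefix n a k₂ b d →
    LexMinInc a k₁ b j Y → LexMinInc a k₂ b d X' →
    ∀ t → t < k₁ → Y t ≤ X' t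
lemma9 n a k₁ k₂ distinct 0<k₁ k₁<k₂ i j b d Y X' _
       (_ , j<n , _) (_ , _ , suffixMax) (_ , _ , _ , prefixMin) LY LX' =
  LexMinInc≤earliestEnd a distinct j<n k₁<k₂ latest prefixMin LY (proj₁ LX')
  where
  latest : LatestStart a k₁ b j
  latest inc@(_ , I) =
    suffixMax (suc b) ≤-refl (≤-trans (IncSub-lower a I 0<k₁) (IncSub-upper a I 0<k₁)) inc
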